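{- There is an infinite family of instances $\{(\mathcal{G}_n,T_{\max,n},\delta_n)\}_{n\in\mathbb{N}}$, with $\mathcal{G}_n$ a simple temporal graph, whose witness complexity grows in $\Omega(|E(\mathcal{G}_n)|)$, where the implied constant is independent of the number $k$ of seed infections allowed per round (i.e., the bound holds for every $k\in\mathbb{N}^+$).
   Context: A simple temporal graph $\mathcal{G}=(V,E,\lambda)$ with lifetime $T_{\max}$ has a finite undirected static graph $(V,E)$ and labeling $\lambda:E\to\{1,\dots,T_{\max}\}$. Infection model with parameter $\delta$: all nodes start susceptible; a seed infection $(v,t)$ makes $v$ infected at time $t$; otherwise a susceptible node $u$ becomes infected at time $t$ iff some node $w$ infectious at time $t$ has an edge $uw$ with $\lambda(uw)=t$ (if several, exactly one infects $u$); a node infected at time $t$ is infectious at times $t+1,\dots,t+\delta$ and resistant afterwards. An infection log is the set of triples $(u,w,s)$ ($u$ infected $w$ at time $s$; seeds as $(u,u,s)$). A witnessing schedule of length $a$ for $\mathcal{G}$ (with parameters $T_{\max},\delta,k$) is a sequence $S_1,\dots,S_a$ of seed infection sets, each of size at most $k$, such that after performing $a$ rounds with these seed sets on $\mathcal{G}$, all labels of $\mathcal{G}$ are uniquely determined (among labelings of the same static graph) by the resulting infection logs. The witness complexity is the length of the shortest witnessing schedule. -}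

module Defs where

open import Data.Nat using (ℕ; zero; suc; _+_; _*_; _≤_; _<_; _⊔_)
open import Data.Fin using (Fin; toℕ)
open import Data.Product using (Σ; _×_; _,_; proj₁; proj₂; ∃-syntax)
open import Data.Sum using (_⊎_)
open import Data.Maybe using (Maybe; just; nothing)
open import Data.List using (List; length; foldr)
open import Data.List.Membership.Propositional using (_∈_)
open import Data.Empty using (⊥)
open import Relation.Nullary using (¬_)
open import Relation.Binary.PropositionalEquality using (_≡_)
open import Function.Definitions using (Injective)

-- Vertices are Fin n; the m edges are indexed by Fin m, each edge e
-- joining ends e = (u , w) with toℕ u < toℕ w (no loops, canonical
-- orientation), and distinct edges have distinct endpoint pairs
-- (no multi-edges).  Hence |E| = m.

record StaticGraph : Set where
  field
    n      : ℕ
    m      : ℕ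
    ends   : Fin m → Fin n × Fin n
    ends-< : ∀ e → toℕ (proj₁ (ends e)) < toℕ (proj₂ (ends e))
    ends-injective : Injective _≡_ _≡_ ends
open StaticGraph public

∣E∣ : StaticGraph → ℕ
∣E∣ G = m G

Joins : (G : StaticGraph) → Fin (m G) → Fin (n G) → Fin (n G) → Set
Joins G e u w = (ends G e ≡ (u , w)) ⊎ (ends G e ≡ (w , u))

Labeling : StaticGraph → Set
Labeling G = Fin (m G) → ℕ

ValidLabeling : (G : StaticGraph) → ℕ → Labeling G → Set
ValidLabeling G Tmax lab = ∀ e → 1 ≤ lab e × lab e ≤ Tmax

Seed : StaticGraph → Set
Seed G = Fin (n G) × ℕ

SeedSet : StaticGraph → Set
SeedSet G = List (Seed G)

-- state / infection log: for each node u, either nothing (not infected)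
-- or just (w , s): u was infected by w at time s (w = u for a seed).
-- This is exactly the infection log {(w , u , s)} of the round, since
-- every node is infected at most once.
Log : StaticGraph → Set
Log G = Fin (n G) → Maybe (Fin (n G) × ℕ)

initial : (G : StaticGraph) → Log G
initial G _ = nothing

Infectious : (G : StaticGraph) → ℕ → Log G → Fin (n G) → ℕ → Set
Infectious G δ σ w t =
  Σ ℕ λ s → Σ (Fin (n G)) λ x → (σ w ≡ just (x , s)) × (s < t) × (t ≤ s + δ)

data NodeStep (G : StaticGraph) (λ' : Labeling G) (δ : ℕ) (S : SeedSet G)
              (t : ℕ) (σ : Log G) (u : Fin (n G))
              : Maybe (Fin (n G) × ℕ) → Set where
  keep     : ∀ x → σ u ≡ just x → NodeStep G λ' δ S t σ u (just x)
  seed     : σ u ≡ nothing → (u , t) ∈ S → NodeStep G λ' δ S t σ u (just (u , t))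
  transmit : ∀ w e → σ u ≡ nothing → ¬ ((u , t) ∈ S) →
             Infectious G δ σ w t → Joins G e u w → λ' e ≡ t →
             NodeStep G λ' δ S t σ u (just (w , t))
  stay     : σ u ≡ nothing → ¬ ((u , t) ∈ S) →
             (∀ w e → Infectious G δ σ w t → Joins G e u w → λ' e ≡ t → ⊥) →
             NodeStep G λ' δ S t σ u nothing

Step : (G : StaticGraph) → Labeling G → ℕ → SeedSet G → ℕ → Log G → Log G → Set
Step G λ' δ S t σ σ' = ∀ u → NodeStep G λ' δ S t σ u (σ' u)

-- Reach t σ : σ is a possible state after processing times 0,…,t-1
data Reach (G : StaticGraph) (λ' : Labeling G) (δ : ℕ) (S : SeedSet G)
           : ℕ → Log G → Set where
  start : Reach G λ' δ S 0 (initial G)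
  next  : ∀ {t σ σ'} → Reach G λ' δ S t σ → Step G λ' δ S t σ σ' →
          Reach G λ' δ S (suc t) σ'

maxSeedTime : {G : StaticGraph} → SeedSet G → ℕ
maxSeedTime = foldr (λ p r → proj₂ p ⊔ r) 0

-- L is a possible infection log of one round with seed set S on (G, λ', δ):
-- all times 0,…,max(Tmax, seed times) are processed (after that nothing
-- can change apart from nothing).
Outcome : (G : StaticGraph) → Labeling G → ℕ → ℕ → SeedSet G → Log G → Set
Outcome G λ' Tmax δ S L = Reach G λ' δ S (suc (Tmax ⊔ maxSeedTime {G} S)) L

Schedule : StaticGraph → ℕ → Set
Schedule G a = Fin a → SeedSet G

Bounded : {G : StaticGraph} {a : ℕ} → ℕ → Schedule G a → Set
Bounded k Sch = ∀ i → length (Sch i) ≤ k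

Witnessing : (G : StaticGraph) (Tmax δ : ℕ) (lab : Labeling G)
             {a : ℕ} → Schedule G a → Set
Witnessing G Tmax δ lab {a} Sch =
  (Ls : Fin a → Log G) →
  (∀ i → Outcome G lab Tmax δ (Sch i) (Ls i)) →
  (λ' : Labeling G) → ValidLabeling G Tmax λ' →
  (∀ i → Outcome G λ' Tmax δ (Sch i) (Ls i)) →
  ∀ e → λ' e ≡ lab e

WitnessingSchedule : (G : StaticGraph) (Tmax δ : ℕ) (lab : Labeling G)
                     (k a : ℕ) → Set
WitnessingSchedule G Tmax δ lab k a =
  Σ (Schedule G a) λ Sch → Bounded {G} {a} k Sch × Witnessing G Tmax δ lab Sch

record Instance : Set where
  field
    graph     : StaticGraph
    Tmax      : ℕ
    δ         : ℕ
    δ-pos     : 1 ≤ δ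
    label     : Labeling graph
    label-ok  : ValidLabeling graph Tmax label
open Instance public

{-# OPTIONS --safe #-}
-- On the star with i edges, edge j labelled j + 1, lifetime 2i and δ = 1, a
-- round reveals the label of an edge only through the infection times of its
-- two ends.  If fewer than i/2 rounds are run, some time l ≤ i is in no round
-- the infection time or the infectious time of the centre, so the edge
-- labelled l never transmits; and some time t' ∈ (i, 2i] is in no round the
-- infectious time of either end of that edge.  Moving its label from l to t'
-- leaves every infection log possible, so the rounds do not determine it.
module Submission where

open import Defs
open import Data.Nat as ℕ using (ℕ; zero; suc; _+_; _*_; _≤_; _<_; _⊔_; z≤n; s≤s; _≤?_; _<?_)
open import Data.Nat.Properties
  using (≤-refl; ≤-trans; ≤-antisym; +-comm; +-identityʳ; m≤m+n; n≤1+n; +-monoʳ-≤;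
         +-monoʳ-<; <-irrefl; <-≤-trans; ≮⇒≥)
open import Data.Fin as Fin using (Fin; toℕ; fromℕ<)
open import Data.Fin.Properties using (any?; toℕ<n; toℕ-fromℕ<; suc-injective)
open import Data.Product using (Σ; _×_; _,_; proj₁; proj₂; ∃; ∃-syntax)
open import Data.Product.Properties using (≡-dec)
open import Data.Sum using (_⊎_; inj₁; inj₂; [_,_])
open import Data.Maybe using (Maybe; just; nothing)
open import Data.List using (List; _++_; length; filter; tabulate)
open import Data.List.Properties using (filter-notAll; length-++; length-tabulate)
open import Data.List.Relation.Unary.Any as Any using ()
open import Data.List.Membership.Propositional using (_∉_)
open import Data.List.Membership.Propositional.Properties
  using (∈-filter⁺; ∈-++⁺ˡ; ∈-++⁺ʳ; ∈-tabulate⁺)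
import Data.List.Membership.DecPropositional as DecMembership
open import Data.Vec.Functional using (updateAt)
open import Data.Vec.Functional.Properties using (updateAt-updates; updateAt-minimal)
open import Data.Empty using (⊥; ⊥-elim)
open import Function using (_∘_; const)
open import Relation.Nullary using (¬_; Dec; yes; no)
open import Relation.Unary using (Decidable)
open import Relation.Nullary.Decidable using (map′; _×-dec_; _⊎-dec_; ¬?)
open import Relation.Binary.PropositionalEquality
  using (_≡_; _≢_; refl; sym; trans; cong; cong₂; subst)

infectious-times : ∀ {G δ} {σ : Log G} {w t x s} → σ w ≡ just (x , s) →
                   Infectious G δ σ w t → s < t × t ≤ s + δ
infectious-times σw≡ (_ , _ , σw≡′ , s<t , t≤s+δ) with trans (sym σw≡) σw≡′
... | refl = s<t , t≤s+δ

infectious? : ∀ G δ (σ : Log G) w t → Dec (Infectious G δ σ w t)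
infectious? G δ σ w t = decide (σ w) refl
  where
  decide : ∀ y → σ w ≡ y → Dec (Infectious G δ σ w t)
  decide nothing σw≡ = no λ (_ , _ , σw≡′ , _) → nothing≢just (trans (sym σw≡) σw≡′)
    where
    nothing≢just : ∀ {A : Set} {a : A} → nothing ≢ just a
    nothing≢just ()
  decide (just (x , s)) σw≡ = map′ (λ (s<t , t≤s+δ) → s , x , σw≡ , s<t , t≤s+δ)
                                   (infectious-times {G} {δ} {σ} {w} σw≡)
                                   (s <? t ×-dec t ≤? s + δ)

joins? : ∀ G e u w → Dec (Joins G e u w)
joins? G e u w = ends G e ≟ (u , w) ⊎-dec ends G e ≟ (w , u)
  where _≟_ = ≡-dec Fin._≟_ Fin._≟_

module _ (G : StaticGraph) (lab : Labeling G) (δ : ℕ) (S : SeedSet G) where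
  open DecMembership (≡-dec (Fin._≟_ {n G}) ℕ._≟_) using (_∈?_)

  nodeStep-exists : ∀ t σ u → ∃ (NodeStep G lab δ S t σ u)
  nodeStep-exists t σ u with σ u in σu≡
  ... | just x = just x , keep x σu≡
  ... | nothing with (u , t) ∈? S
  ...   | yes seeded = just (u , t) , seed σu≡ seeded
  ...   | no unseeded
          with any? (λ w → any? (λ e →
                 infectious? G δ σ w t ×-dec joins? G e u w ×-dec lab e ℕ.≟ t))
  ...     | yes (w , e , inf , joins , lab≡) =
              just (w , t) , transmit w e σu≡ unseeded inf joins lab≡
  ...     | no none =
              nothing , stay σu≡ unseeded λ w e inf joins lab≡ → none (w , e , inf , joins , lab≡)

  reach-exists : ∀ t → ∃ (Reach G lab δ S t)
  reach-exists zero = initial G , start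
  reach-exists (suc t) with reach-exists t
  ... | σ , reach = (λ u → proj₁ (nodeStep-exists t σ u))
                  , next reach (λ u → proj₂ (nodeStep-exists t σ u))

outcome-exists : ∀ G lab Tmax δ S → ∃ (Outcome G lab Tmax δ S)
outcome-exists G lab Tmax δ S = reach-exists G lab δ S (suc (Tmax ⊔ maxSeedTime {G} S))

Transmits : (G : StaticGraph) → ℕ → Log G → Fin (m G) → ℕ → Set
Transmits G δ L e t =
  ∃[ u ] ∃[ w ] Joins G e u w × Infectious G δ L w t × L u ≡ just (w , t)

HasInfectiousEnd : (G : StaticGraph) → ℕ → Log G → Fin (m G) → ℕ → Set
HasInfectiousEnd G δ L e t = ∃[ u ] ∃[ w ] Joins G e u w × Infectious G δ L w t

LogPrefix : (G : StaticGraph) → Log G → Log G → Set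
LogPrefix G σ L = ∀ u x → σ u ≡ just x → L u ≡ just x

syntax LogPrefix G σ L = σ ⊑⟨ G ⟩ L

⊑-refl : ∀ {G} {L : Log G} → L ⊑⟨ G ⟩ L
⊑-refl u x L≡ = L≡

nodeStep-keeps : ∀ {G lab δ S t σ u y} → NodeStep G lab δ S t σ u y →
                 ∀ x → σ u ≡ just x → y ≡ just x
nodeStep-keeps (keep _ σu≡) x σu≡′ = trans (sym σu≡) σu≡′
nodeStep-keeps (seed σu≡ _) x σu≡′ with trans (sym σu≡) σu≡′
... | ()
nodeStep-keeps (transmit _ _ σu≡ _ _ _ _) x σu≡′ with trans (sym σu≡) σu≡′
... | ()
nodeStep-keeps (stay σu≡ _ _) x σu≡′ with trans (sym σu≡) σu≡′
... | ()

infectious-mono : ∀ {G δ} {σ L : Log G} {w t} → σ ⊑⟨ G ⟩ L →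
                  Infectious G δ σ w t → Infectious G δ L w t
infectious-mono σ⊑L (s , x , σw≡ , s<t , t≤s+δ) = s , x , σ⊑L _ _ σw≡ , s<t , t≤s+δ

-- Runs are replayed against their final log L: every intermediate state is
-- below L, so the two silence hypotheses about L apply at every step.
module _ {G : StaticGraph} {lab : Labeling G} {δ : ℕ} {S : SeedSet G}
         {L : Log G} {e : Fin (m G)} {t′ : ℕ}
         (silent : ¬ Transmits G δ L e (lab e))
         (quiet : ¬ HasInfectiousEnd G δ L e t′) where

  private
    lab′ : Labeling G
    lab′ = updateAt lab e (const t′)

  nodeStep-relabel : ∀ {t σ u y} → σ ⊑⟨ G ⟩ L → (∀ x → y ≡ just x → L u ≡ just x) →
                     NodeStep G lab δ S t σ u y → NodeStep G lab′ δ S t σ u y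
  nodeStep-relabel _ _ (keep x σu≡) = keep x σu≡
  nodeStep-relabel _ _ (seed σu≡ seeded) = seed σu≡ seeded
  nodeStep-relabel {σ = σ} {u} σ⊑L y⊑L (transmit w e″ σu≡ unseeded inf joins lab≡)
    with e″ Fin.≟ e | lab≡
  ... | no e″≢e | _ =
    transmit w e″ σu≡ unseeded inf joins (trans (updateAt-minimal e″ e {const t′} lab e″≢e) lab≡)
  ... | yes refl | refl =
    ⊥-elim (silent (u , w , joins , infectious-mono {G} {δ} {σ} {L} σ⊑L inf , y⊑L _ refl))
  nodeStep-relabel {t} {σ} {u} σ⊑L _ (stay σu≡ unseeded none) = stay σu≡ unseeded none′
    where
    none′ : ∀ w e″ → Infectious G δ σ w t → Joins G e″ u w → lab′ e″ ≡ t → ⊥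
    none′ w e″ inf joins lab′≡ with e″ Fin.≟ e
    ... | no e″≢e =
      none w e″ inf joins (trans (sym (updateAt-minimal e″ e {const t′} lab e″≢e)) lab′≡)
    ... | yes refl with trans (sym (updateAt-updates e {const t′} lab)) lab′≡
    ...   | refl = quiet (u , w , joins , infectious-mono {G} {δ} {σ} {L} σ⊑L inf)

  reach-relabel : ∀ {t σ} → Reach G lab δ S t σ → σ ⊑⟨ G ⟩ L → Reach G lab′ δ S t σ
  reach-relabel start _ = start
  reach-relabel (next reach step) σ′⊑L =
    next (reach-relabel reach σ⊑L) (λ u → nodeStep-relabel σ⊑L (σ′⊑L u) (step u))
    where
    σ⊑L : _ ⊑⟨ G ⟩ L
    σ⊑L u x σu≡ = σ′⊑L u x (nodeStep-keeps (step u) x σu≡)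

witnessing-pins-label :
  ∀ {G Tmax δ lab a} {Sch : Schedule G a} →
  Witnessing G Tmax δ lab Sch → ValidLabeling G Tmax lab →
  (Ls : Fin a → Log G) → (∀ r → Outcome G lab Tmax δ (Sch r) (Ls r)) →
  ∀ e {t′} → 1 ≤ t′ → t′ ≤ Tmax →
  (∀ r → ¬ Transmits G δ (Ls r) e (lab e)) →
  (∀ r → ¬ HasInfectiousEnd G δ (Ls r) e t′) →
  t′ ≡ lab e
witnessing-pins-label {G} {Tmax} {δ} {lab} {Sch = Sch}
                      wit valid Ls outcomes e {t′} 1≤t′ t′≤Tmax silent quiet =
  trans (sym (updateAt-updates e {const t′} lab))
        (wit Ls outcomes lab′ valid′ relabelled e)
  where
  lab′ : Labeling G
  lab′ = updateAt lab e (const t′)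

  InRange : ℕ → Set
  InRange l = 1 ≤ l × l ≤ Tmax

  valid′ : ValidLabeling G Tmax lab′
  valid′ e″ with e″ Fin.≟ e
  ... | yes refl = subst InRange (sym (updateAt-updates e {const t′} lab)) (1≤t′ , t′≤Tmax)
  ... | no e″≢e = subst InRange (sym (updateAt-minimal e″ e {const t′} lab e″≢e)) (valid e″)

  relabelled : ∀ r → Outcome G lab′ Tmax δ (Sch r) (Ls r)
  relabelled r = reach-relabel (silent r) (quiet r) (outcomes r) (⊑-refl {G} {Ls r})

∃-∉-between : ∀ b m (xs : List ℕ) → length xs < m → ∃[ k ] b ≤ k × k < b + m × k ∉ xs
∃-∉-between b (suc m) xs (s≤s |xs|≤m) with DecMembership._∈?_ ℕ._≟_ (b + m) xs
... | no top∉ = b + m , m≤m+n b m , +-monoʳ-< b ≤-refl , top∉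
... | yes top∈ = widen (∃-∉-between b m (filter ≢top? xs) shorter)
  where
  ≢top? : Decidable (_≢ b + m)
  ≢top? y = ¬? (y ℕ.≟ b + m)

  shorter : length (filter ≢top? xs) < m
  shorter = <-≤-trans (filter-notAll ≢top? xs (Any.map (λ top≡ ≢top → ≢top (sym top≡)) top∈))
                      |xs|≤m

  widen : ∃[ k ] b ≤ k × k < b + m × k ∉ filter ≢top? xs →
          ∃[ k ] b ≤ k × k < b + suc m × k ∉ xs
  widen (k , b≤k , k<b+m , k∉) =
    k , b≤k , <-≤-trans k<b+m (+-monoʳ-≤ b (n≤1+n m)) ,
    λ k∈ → k∉ (∈-filter⁺ ≢top? k∈ λ { refl → <-irrefl refl k<b+m })

∃-avoiding : ∀ {a} b m (f g : Fin a → ℕ) → a + a < m →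
             ∃[ k ] b ≤ k × k < b + m × (∀ r → ¬ (f r ≡ k ⊎ g r ≡ k))
∃-avoiding {a} b m f g 2a<m
  with ∃-∉-between b m (tabulate f ++ tabulate g) (subst (_< m) (sym length≡) 2a<m)
  where
  length≡ : length (tabulate f ++ tabulate g) ≡ a + a
  length≡ = trans (length-++ (tabulate f)) (cong₂ _+_ (length-tabulate f) (length-tabulate g))
... | k , b≤k , k<b+m , k∉ = k , b≤k , k<b+m , λ r →
  [ (λ { refl → k∉ (∈-++⁺ˡ (∈-tabulate⁺ r)) })
  , (λ { refl → k∉ (∈-++⁺ʳ (tabulate f) (∈-tabulate⁺ r)) })
  ]

star : ℕ → StaticGraph
star i = record
  { n = suc i
  ; m = i
  ; ends = λ j → Fin.zero , Fin.suc j
  ; ends-< = λ _ → s≤s z≤n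
  ; ends-injective = λ ends≡ → suc-injective (cong proj₂ ends≡)
  }

starLabel : ∀ i → Labeling (star i)
starLabel i j = suc (toℕ j)

starLabel-valid : ∀ i → ValidLabeling (star i) (i + i) (starLabel i)
starLabel-valid i j = s≤s z≤n , ≤-trans (toℕ<n j) (m≤m+n i i)

starInstance : ℕ → Instance
starInstance i = record
  { graph = star i ; Tmax = i + i ; δ = 1 ; δ-pos = ≤-refl
  ; label = starLabel i ; label-ok = starLabel-valid i }

infectionTime : ∀ {n} → Maybe (Fin n × ℕ) → ℕ
infectionTime nothing = 0
infectionTime (just (_ , s)) = s

infectious₁-time : ∀ {G} {L : Log G} {w t} → Infectious G 1 L w t → suc (infectionTime (L w)) ≡ t
infectious₁-time {t = t} (s , _ , Lw≡ , s<t , t≤s+1) rewrite Lw≡ =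
  ≤-antisym s<t (subst (t ≤_) (+-comm s 1) t≤s+1)

star-transmits : ∀ {i} {L : Log (star i)} {j t} → Transmits (star i) 1 L j t →
                 infectionTime (L Fin.zero) ≡ t ⊎ suc (infectionTime (L Fin.zero)) ≡ t
star-transmits (_ , _ , inj₁ refl , _ , Lu≡) = inj₁ (cong infectionTime Lu≡)
star-transmits {i} {L} (_ , _ , inj₂ refl , inf , _) = inj₂ (infectious₁-time {star i} {L} inf)

star-infectiousEnd : ∀ {i} {L : Log (star i)} {j t} → HasInfectiousEnd (star i) 1 L j t →
                     suc (infectionTime (L Fin.zero)) ≡ t ⊎ suc (infectionTime (L (Fin.suc j))) ≡ t
star-infectiousEnd {i} {L} (_ , _ , inj₁ refl , inf) = inj₂ (infectious₁-time {star i} {L} inf)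
star-infectiousEnd {i} {L} (_ , _ , inj₂ refl , inf) = inj₁ (infectious₁-time {star i} {L} inf)

module _ (i : ℕ) {a : ℕ} (Sch : Schedule (star i) a) where
  private
    outcome : ∀ r → ∃ (Outcome (star i) (starLabel i) (i + i) 1 (Sch r))
    outcome r = outcome-exists (star i) (starLabel i) (i + i) 1 (Sch r)

    Ls : Fin a → Log (star i)
    Ls r = proj₁ (outcome r)

    timeOf : Fin (suc i) → Fin a → ℕ
    timeOf v r = infectionTime (Ls r v)

  star-rounds-bound : Witnessing (star i) (i + i) 1 (starLabel i) Sch → ¬ (a + a < i)
  star-rounds-bound wit 2a<i
    with ∃-avoiding 1 i (timeOf Fin.zero) (suc ∘ timeOf Fin.zero) 2a<i
  ... | suc l , _ , s≤s l<i , centre-idle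
    with ∃-avoiding (suc i) i (suc ∘ timeOf Fin.zero) (suc ∘ timeOf (Fin.suc (fromℕ< l<i))) 2a<i
  ... | t′ , i<t′ , s≤s t′≤2i , ends-quiet =
    <-irrefl refl (<-≤-trans i<t′ (subst (_≤ i) (sym pinned) (toℕ<n j)))
    where
    j : Fin i
    j = fromℕ< l<i

    silent : ∀ r → ¬ Transmits (star i) 1 (Ls r) j (starLabel i j)
    silent r transmits =
      centre-idle r (star-transmits (subst (Transmits (star i) 1 (Ls r) j) label≡ transmits))
      where
      label≡ : starLabel i j ≡ suc l
      label≡ = cong suc (toℕ-fromℕ< l<i)

    quiet : ∀ r → ¬ HasInfectiousEnd (star i) 1 (Ls r) j t′
    quiet r = ends-quiet r ∘ star-infectiousEnd

    pinned : t′ ≡ starLabel i j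
    pinned = witnessing-pins-label wit (starLabel-valid i) Ls (proj₂ ∘ outcome) j
               (≤-trans (s≤s z≤n) i<t′) t′≤2i silent quiet

theorem7 : Σ (ℕ → Instance) λ inst →
    ((M : ℕ) → Σ ℕ λ i → M ≤ ∣E∣ (graph (inst i))) ×
    Σ ℕ λ d → 1 ≤ d × Σ ℕ λ N →
      ∀ (k : ℕ) → 1 ≤ k → ∀ (i : ℕ) → N ≤ i →
        ∀ (a : ℕ) → WitnessingSchedule (graph (inst i)) (Tmax (inst i)) (δ (inst i)) (label (inst i)) k a →
          ∣E∣ (graph (inst i)) ≤ d * a
theorem7 = starInstance , (λ M → M , ≤-refl) , 2 , s≤s z≤n , 0 , bound
  where
  bound : ∀ k → 1 ≤ k → ∀ i → 0 ≤ i → ∀ a →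
          WitnessingSchedule (star i) (i + i) 1 (starLabel i) k a → i ≤ 2 * a
  bound _ _ i _ a (Sch , _ , wit) =
    subst (i ≤_) (cong (a +_) (sym (+-identityʳ a))) (≮⇒≥ (star-rounds-bound i Sch wit))
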